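{- Let $p$ and $q$ be prime numbers. If there exist $i,j \in \{0,1,2\}$ such that $2^i p - 1 \equiv 0 \pmod{q}$ and $2^j q - 1 \equiv 0 \pmod{p}$, then $\min(p,q) \le 5$. -}

module Defs where

{-# OPTIONS --safe #-}
module Submission where

-- Write 2^i p = 1 + k q and 2^j q = 1 + m p. Substituting one equation into
-- the other gives (2^(i+j) - k m) p = 2^j + k, so p ≤ 2^j + k ≤ 4 + k; feeding
-- this back into 2^i p = 1 + k q with q ≥ 6 forces k ≤ 7, hence p ≤ 11, and
-- symmetrically q ≤ 11. The finitely many remaining cases are decided by
-- computation.

open import Defs
open import Data.Nat
  using (ℕ; zero; suc; pred; _+_; _*_; _∸_; _^_; _≤_; _<_; _⊓_; z≤n; s≤s; s≤s⁻¹; _≤?_; NonZero)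
open import Data.Nat.Properties
open import Data.Nat.Divisibility using (_∣_; divides; _∣?_)
open import Data.Nat.Primality using (Prime; prime?; prime⇒nonZero)
open import Data.Nat.Tactic.RingSolver using (solve)
open import Data.List using (_∷_; [])
open import Data.Product using (∃; ∃₂; _×_; _,_)
open import Data.Empty using (⊥-elim)
open import Relation.Nullary using (¬_; Dec; yes; no; ¬?)
open import Relation.Nullary.Decidable using (toWitness; _×-dec_)
open import Relation.Binary.PropositionalEquality using (_≡_; sym; trans; cong; module ≡-Reasoning)

∣pred⇒≡suc : ∀ {n q} .{{_ : NonZero n}} → q ∣ pred n → ∃ λ k → n ≡ suc (k * q)
∣pred⇒≡suc {n} (divides k pred[n]≡kq) = k , trans (sym (suc-pred n)) (cong suc pred[n]≡kq)

m*o≡n+l*o⇒o≤n : ∀ m n l o → m * o ≡ n + l * o → 0 < n → o ≤ n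
m*o≡n+l*o⇒o≤n m n l o eq 0<n with m ≤? l
... | yes m≤l = ⊥-elim (<⇒≱ lo<mo (*-monoˡ-≤ o m≤l))
  where
  lo<mo : l * o < m * o
  lo<mo = ≤-trans (+-monoˡ-≤ (l * o) 0<n) (≤-reflexive (sym eq))
... | no m≰l = +-cancelʳ-≤ (l * o) o n (≤-trans (*-monoˡ-≤ o (≰⇒> m≰l)) (≤-reflexive eq))

cross-identity : ∀ a b k m p q → a * p ≡ suc (k * q) → b * q ≡ suc (m * p) →
                 (b * a) * p ≡ (b + k) + (k * m) * p
cross-identity a b k m p q ap≡ bq≡ = begin
  (b * a) * p         ≡⟨ *-assoc b a p ⟩
  b * (a * p)         ≡⟨ cong (b *_) ap≡ ⟩
  b * suc (k * q)     ≡⟨ solve (b ∷ k ∷ q ∷ []) ⟩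
  b + k * (b * q)     ≡⟨ cong (λ x → b + k * x) bq≡ ⟩
  b + k * suc (m * p) ≡⟨ solve (b ∷ k ∷ m ∷ p ∷ []) ⟩
  (b + k) + (k * m) * p ∎
  where open ≡-Reasoning

cross-bound : ∀ a b k m p q → a * p ≡ suc (k * q) → b * q ≡ suc (m * p) → p ≤ b + k
cross-bound a zero    k m p q ap≡ ()
cross-bound a (suc b) k m p q ap≡ bq≡ =
  m*o≡n+l*o⇒o≤n (suc b * a) (suc b + k) (k * m) p (cross-identity a (suc b) k m p q ap≡ bq≡) (s≤s z≤n)

quotient≤7 : ∀ {a k p q} → a ≤ 4 → 6 ≤ q → p ≤ 4 + k → a * p ≡ suc (k * q) → k ≤ 7
quotient≤7 {a} {k} {p} {q} a≤4 6≤q p≤4+k ap≡ =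
  s≤s⁻¹ (*-cancelˡ-< 2 k 8 (+-cancelˡ-< (4 * k) (2 * k) 16 4k+2k<4k+16))
  where
  open ≤-Reasoning
  4k+2k<4k+16 : 4 * k + 2 * k < 4 * k + 16
  4k+2k<4k+16 = begin-strict
    4 * k + 2 * k ≡⟨ solve (k ∷ []) ⟩
    k * 6         ≤⟨ *-monoʳ-≤ k 6≤q ⟩
    k * q         <⟨ ≤-refl ⟩
    suc (k * q)   ≡⟨ sym ap≡ ⟩
    a * p         ≤⟨ *-mono-≤ a≤4 p≤4+k ⟩
    4 * (4 + k)   ≡⟨ solve (k ∷ []) ⟩
    4 * k + 16    ∎

mutual-divisor≤11 : ∀ {a b p q} .{{_ : NonZero (a * p)}} .{{_ : NonZero (b * q)}} →
                    a ≤ 4 → b ≤ 4 → 6 ≤ q → q ∣ pred (a * p) → p ∣ pred (b * q) → p ≤ 11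
mutual-divisor≤11 {a} {b} {p} {q} a≤4 b≤4 6≤q q∣ p∣
  with k , ap≡ ← ∣pred⇒≡suc q∣ | m , bq≡ ← ∣pred⇒≡suc p∣ =
  ≤-trans p≤b+k (+-mono-≤ b≤4 (quotient≤7 a≤4 6≤q (≤-trans p≤b+k (+-monoˡ-≤ k b≤4)) ap≡))
  where
  p≤b+k : p ≤ b + k
  p≤b+k = cross-bound a b k m p q ap≡ bq≡

Counterexample : ℕ → ℕ → ℕ → ℕ → Set
Counterexample p q i j =
  6 ≤ p × 6 ≤ q × Prime p × Prime q × q ∣ pred (2 ^ i * p) × p ∣ pred (2 ^ j * q)

counterexample? : ∀ p q i j → Dec (Counterexample p q i j)
counterexample? p q i j =
  (6 ≤? p) ×-dec (6 ≤? q) ×-dec prime? p ×-dec prime? q ×-dec (q ∣? _) ×-dec (p ∣? _)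

no-small-counterexample : ∀ {p} → p < 12 → ∀ {q} → q < 12 → ∀ {i} → i < 3 → ∀ {j} → j < 3 →
                          ¬ Counterexample p q i j
no-small-counterexample =
  toWitness {a? = allUpTo? (λ p → allUpTo? (λ q → allUpTo? (λ i → allUpTo? (λ j →
                    ¬? (counterexample? p q i j)) 3) 3) 12) 12} _

lemma2p19 : (p q : ℕ) → Prime p → Prime q →
            ∃₂ (λ i j → i ≤ 2 × j ≤ 2 × q ∣ (2 ^ i * p ∸ 1) × p ∣ (2 ^ j * q ∸ 1)) →
            p ⊓ q ≤ 5
lemma2p19 p q pp pq (i , j , i≤2 , j≤2 , q∣ , p∣) with p ⊓ q ≤? 5
... | yes p⊓q≤5 = p⊓q≤5
... | no p⊓q≰5 =
  ⊥-elim (no-small-counterexample (s≤s p≤11) (s≤s q≤11) (s≤s i≤2) (s≤s j≤2)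
                                  (6≤p , 6≤q , pp , pq , q∣ , p∣))
  where
  instance
    p≢0 : NonZero p
    p≢0 = prime⇒nonZero pp
    q≢0 : NonZero q
    q≢0 = prime⇒nonZero pq
    2^ip≢0 : NonZero (2 ^ i * p)
    2^ip≢0 = m*n≢0 (2 ^ i) p {{m^n≢0 2 i}}
    2^jq≢0 : NonZero (2 ^ j * q)
    2^jq≢0 = m*n≢0 (2 ^ j) q {{m^n≢0 2 j}}
  6≤p : 6 ≤ p
  6≤p = ≤-trans (≰⇒> p⊓q≰5) (m⊓n≤m p q)
  6≤q : 6 ≤ q
  6≤q = ≤-trans (≰⇒> p⊓q≰5) (m⊓n≤n p q)
  p≤11 : p ≤ 11
  p≤11 = mutual-divisor≤11 (^-monoʳ-≤ 2 i≤2) (^-monoʳ-≤ 2 j≤2) 6≤q q∣ p∣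
  q≤11 : q ≤ 11
  q≤11 = mutual-divisor≤11 (^-monoʳ-≤ 2 j≤2) (^-monoʳ-≤ 2 i≤2) 6≤p p∣ q∣
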